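{- For every circular area sequence $\mathbf a$ of length $n$, the coefficient of $\mathrm e_{1^n}(\mathbf x)=\mathrm e_1(\mathbf x)^n$ in the elementary symmetric function expansion of $\mathrm G_{\mathbf a}(\mathbf x;q+1)$ equals $1$.
   Context: A circular area sequence is an integer sequence $\mathbf a=(a_1,\dots,a_n)$ with $0\le a_i\le n-1$ and $a_i-1\le a_{i+1}$ for all $i$, indices mod $n$. $\Gamma_{\mathbf a}$ is the directed graph on $[n]$ with edges $i\to i+1,\dots,i\to i+a_i$ (labels mod $n$). $\mathrm G_{\mathbf a}(\mathbf x;q)=\sum_F\mathbf x^F q^{\mathrm{asc}_{\mathbf a}(F)}$ over all maps $F:[n]\to\mathbb Z_{>0}$, where $\mathbf x^F=\prod_vx_{F(v)}$ and $\mathrm{asc}_{\mathbf a}(F)$ is the number of edges $i\to j$ of $\Gamma_{\mathbf a}$ with $F(i)<F(j)$; it is a symmetric function. -}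

module Defs where

open import Data.Nat as ℕ using (ℕ; zero; suc; _∸_; _⊓_; NonZero)
open import Data.Nat.DivMod using (_%_; m%n<n)
open import Data.Fin as Fin using (Fin; toℕ; fromℕ<)
open import Data.Fin.Base using () renaming (_<_ to _<ᶠ_)
open import Data.Integer as ℤ using (ℤ; _+_; _*_; _^_)
open import Data.List as List using (List; []; _∷_; [_]; map; concatMap; upTo; allFin; foldr; length)
open import Data.Vec.Functional as VF using (Vector)
open import Data.Product using (_×_)
open import Relation.Nullary.Decidable using (⌊_⌋)
open import Data.Bool using (Bool; true; false; if_then_else_)

idx : (n : ℕ) → .{{_ : NonZero n}} → ℕ → Fin n
idx n k = fromℕ< (m%n<n k n)

IsCircularAreaSeq : (n : ℕ) → .{{_ : NonZero n}} → (Fin n → ℕ) → Set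
IsCircularAreaSeq n a =
  ∀ (i : Fin n) → (a i ℕ.< n) × (a i ℕ.≤ suc (a (idx n (suc (toℕ i)))))

sumℤ : List ℤ → ℤ
sumℤ = foldr _+_ (ℤ.+ 0)

prodℤ : List ℤ → ℤ
prodℤ = foldr _*_ (ℤ.+ 1)

countTrue : List Bool → ℕ
countTrue = foldr (λ b k → if b then suc k else k) 0

sumMaps : (k N : ℕ) → ((Fin k → Fin N) → ℤ) → ℤ
sumMaps zero    N g = g (λ ())
sumMaps (suc k) N g = sumℤ (map (λ c → sumMaps k N (λ h → g (c VF.∷ h))) (allFin N))

-- The graph Γ_a and ascents
-- Edges of Γ_a: i → i+d (mod n) for d = 1,…,a_i.

asc : (n : ℕ) → .{{_ : NonZero n}} → (a : Fin n → ℕ) → {N : ℕ} → (Fin n → Fin N) → ℕ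
asc n a F =
  countTrue (concatMap
    (λ i → map (λ d → ⌊ F i Fin.<? F (idx n (toℕ i ℕ.+ suc d)) ⌋) (upTo (a i)))
    (allFin n))

-- G_a(x; t) specialised to the finitely many variables x_1,…,x_N
-- (x_j = 0 for j > N), evaluated at integer values x and t:
--   Σ_{F : [n] → [N]} (Π_v x_{F v}) t^{asc_a(F)}
Gspec : (n : ℕ) → .{{_ : NonZero n}} → (a : Fin n → ℕ) →
        (N : ℕ) → (x : Fin N → ℤ) → (t : ℤ) → ℤ
Gspec n a N x t =
  sumMaps n N (λ F → prodℤ (map (λ v → x (F v)) (allFin n)) * (t ^ asc n a F))

elem : ℕ → List ℤ → ℤ
elem zero    _        = ℤ.+ 1
elem (suc k) []       = ℤ.+ 0
elem (suc k) (x ∷ xs) = elem (suc k) xs + x * elem k xs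

elemP : List ℕ → List ℤ → ℤ
elemP λs xs = prodℤ (map (λ k → elem k xs) λs)

-- Partitions of n, as weakly decreasing lists of positive parts

-- partsF fuel n m : partitions of n with all parts ≤ m (fuel ≥ n suffices)
partsF : ℕ → ℕ → ℕ → List (List ℕ)
partsF _        zero    m = [ [] ]
partsF zero     (suc n) m = []
partsF (suc f)  (suc n) m =
  concatMap (λ k → map (suc k ∷_) (partsF f (suc n ∸ suc k) (suc k)))
            (upTo (m ⊓ suc n))

partitions : ℕ → List (List ℕ)
partitions n = partsF n n n

eExpansion : (n : ℕ) → (List ℕ → ℤ) → List ℤ → ℤ
eExpansion n c xs = sumℤ (map (λ λs → c λs * elemP λs xs) (partitions n))

{-# OPTIONS --safe #-}
-- Specialise to the single variable x₁ = 1.  A colouring with one colour is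
-- constant, so it has no ascents and G_a(1; t) = 1 for every t.  On the other
-- side e_k(1) = 0 for k ≥ 2, so every e_λ with a part ≥ 2 vanishes and the
-- e-expansion collapses to the coefficient of e_{1ⁿ}.
module Submission where

open import Defs
import Data.Nat as ℕ
open import Data.Nat using (ℕ; NonZero; zero; suc; _≤_; _∸_; _⊓_; z≤n; s≤s)
open import Data.Nat.Properties using (≤-refl)
open import Data.Fin using (Fin; zero; toℕ; _<?_)
open import Data.Fin.Properties using (<-irrefl)
open import Data.Integer using (ℤ; +_; _+_; _*_; _^_)
open import Data.Integer.Properties using (+-identityˡ; +-identityʳ; +-assoc; *-identityˡ; *-identityʳ; *-zeroˡ; *-zeroʳ)
open import Data.List using (List; []; _∷_; [_]; _++_; map; concatMap; applyUpTo; replicate; allFin; upTo)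
open import Data.List.Properties using (map-++; map-∘; map-cong)
open import Data.List.Relation.Unary.All using (All; []; _∷_; universal)
open import Data.List.Relation.Unary.All.Properties using (map⁺; concat⁺; applyUpTo⁺₂)
open import Data.Vec.Functional using (toList)
open import Function using (_∘_)
open import Data.Bool using (false)
open import Relation.Nullary.Decidable using (⌊_⌋; isYes≗does; dec-false)
open import Relation.Binary.PropositionalEquality using (_≡_; refl; sym; trans; cong; cong₂; module ≡-Reasoning)
open ≡-Reasoning

sumℤ-++ : ∀ xs ys → sumℤ (xs ++ ys) ≡ sumℤ xs + sumℤ ys
sumℤ-++ []       ys = sym (+-identityˡ (sumℤ ys))
sumℤ-++ (x ∷ xs) ys = trans (cong (_+_ x) (sumℤ-++ xs ys)) (sym (+-assoc x _ _))

sumℤ-zeros : ∀ {xs} → All (_≡ + 0) xs → sumℤ xs ≡ + 0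
sumℤ-zeros []           = refl
sumℤ-zeros (refl ∷ xs≡0) = cong (_+_ (+ 0)) (sumℤ-zeros xs≡0)

prodℤ-ones : ∀ {xs} → All (_≡ + 1) xs → prodℤ xs ≡ + 1
prodℤ-ones []            = refl
prodℤ-ones (refl ∷ xs≡1) = cong (_*_ (+ 1)) (prodℤ-ones xs≡1)

countTrue-falses : ∀ {bs} → All (_≡ false) bs → countTrue bs ≡ 0
countTrue-falses []              = refl
countTrue-falses (refl ∷ bs≡ff) = countTrue-falses bs≡ff

asc-monochromatic : (n : ℕ) → .{{_ : NonZero n}} → (a : Fin n → ℕ) →
                    {N : ℕ} (F : Fin n → Fin N) (k : Fin N) →
                    (∀ i → F i ≡ k) → asc n a F ≡ 0
asc-monochromatic n a F k F≡k =
  countTrue-falses (concat⁺ (map⁺ (universal noAscentFrom (allFin n))))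
  where
  noAscent : ∀ i j → ⌊ F i <? F j ⌋ ≡ false
  noAscent i j = trans (isYes≗does (F i <? F j))
                       (dec-false (F i <? F j) (<-irrefl (trans (F≡k i) (sym (F≡k j)))))

  noAscentFrom : ∀ i → All (_≡ false) (map (λ d → ⌊ F i <? F (idx n (toℕ i ℕ.+ suc d)) ⌋) (upTo (a i)))
  noAscentFrom i = map⁺ (universal (λ d → noAscent i (idx n (toℕ i ℕ.+ suc d))) (upTo (a i)))

sumMaps-one-colour : ∀ k (g : (Fin k → Fin 1) → ℤ) {z : ℤ} →
                     (∀ F → g F ≡ z) → sumMaps k 1 g ≡ z
sumMaps-one-colour zero    g g≡z = g≡z _
sumMaps-one-colour (suc k) g g≡z =
  trans (+-identityʳ _) (sumMaps-one-colour k _ (λ F → g≡z _))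

Gspec-at-one : (n : ℕ) → .{{_ : NonZero n}} → (a : Fin n → ℕ) → (t : ℤ) →
                      Gspec n a 1 (λ _ → + 1) t ≡ + 1
Gspec-at-one n a t = sumMaps-one-colour n _ summand≡1
  where
  only-zero : (i : Fin 1) → i ≡ zero
  only-zero zero = refl

  summand≡1 : ∀ F → prodℤ (map (λ _ → + 1) (allFin n)) * t ^ asc n a F ≡ + 1
  summand≡1 F = cong₂ (λ p e → p * t ^ e)
                      (prodℤ-ones (map⁺ (universal (λ _ → refl) (allFin n))))
                      (asc-monochromatic n a F zero (λ i → only-zero (F i)))

elemP-1∷ : ∀ λs → elemP (1 ∷ λs) [ + 1 ] ≡ elemP λs [ + 1 ]
elemP-1∷ λs = *-identityˡ (elemP λs [ + 1 ])

elemP-2+k∷ : ∀ k λs → elemP (suc (suc k) ∷ λs) [ + 1 ] ≡ + 0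
elemP-2+k∷ k λs = *-zeroˡ (elemP λs [ + 1 ])

partsF-sum-at-one : (c : List ℕ → ℤ) → ∀ f n m → n ≤ f →
                    sumℤ (map (λ λs → c λs * elemP λs [ + 1 ]) (partsF f n (suc m)))
                      ≡ c (replicate n 1)
partsF-sum-at-one c f       zero    m _         = trans (+-identityʳ _) (*-identityʳ (c []))
partsF-sum-at-one c (suc f) (suc n) m (s≤s n≤f) = begin
  sumℤ (map w (onesFirst ++ rest))           ≡⟨ cong sumℤ (map-++ w onesFirst rest) ⟩
  sumℤ (map w onesFirst ++ map w rest)       ≡⟨ sumℤ-++ (map w onesFirst) (map w rest) ⟩
  sumℤ (map w onesFirst) + sumℤ (map w rest) ≡⟨ cong₂ _+_ leading vanishing ⟩
  c (replicate (suc n) 1) + + 0              ≡⟨ +-identityʳ _ ⟩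
  c (replicate (suc n) 1)                    ∎
  where
  w : List ℕ → ℤ
  w λs = c λs * elemP λs [ + 1 ]

  -- partsF (suc f) (suc n) (suc m) computes to onesFirst ++ rest: the
  -- partitions with first part 1, then those with first part 2 + k.
  onesFirst : List (List ℕ)
  onesFirst = map (1 ∷_) (partsF f n 1)

  rest : List (List ℕ)
  rest = concatMap (λ k → map (suc k ∷_) (partsF f (n ∸ k) (suc k))) (applyUpTo suc (m ⊓ n))

  leading : sumℤ (map w onesFirst) ≡ c (replicate (suc n) 1)
  leading = begin
    sumℤ (map w onesFirst)                                        ≡⟨ cong sumℤ (map-∘ (partsF f n 1)) ⟨
    sumℤ (map (λ μ → c (1 ∷ μ) * elemP (1 ∷ μ) [ + 1 ]) (partsF f n 1))
      ≡⟨ cong sumℤ (map-cong (λ μ → cong (_*_ (c (1 ∷ μ))) (elemP-1∷ μ)) (partsF f n 1)) ⟩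
    sumℤ (map (λ μ → c (1 ∷ μ) * elemP μ [ + 1 ]) (partsF f n 1)) ≡⟨ partsF-sum-at-one (c ∘ (1 ∷_)) f n 0 n≤f ⟩
    c (replicate (suc n) 1)                                       ∎

  w-2+k∷≡0 : ∀ k μ → w (suc (suc k) ∷ μ) ≡ + 0
  w-2+k∷≡0 k μ = trans (cong (_*_ (c (suc (suc k) ∷ μ))) (elemP-2+k∷ k μ))
                       (*-zeroʳ (c (suc (suc k) ∷ μ)))

  vanishing : sumℤ (map w rest) ≡ + 0
  vanishing = sumℤ-zeros (map⁺ (concat⁺ (map⁺ (applyUpTo⁺₂ suc (m ⊓ n)
                (λ k → map⁺ (universal (w-2+k∷≡0 k) (partsF f (n ∸ suc k) (suc (suc k)))))))))

eExpansion-at-one : ∀ n (c : List ℕ → ℤ) → eExpansion n c [ + 1 ] ≡ c (replicate n 1)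
eExpansion-at-one zero    c = partsF-sum-at-one c 0 0 0 z≤n
eExpansion-at-one (suc n) c = partsF-sum-at-one c (suc n) (suc n) n ≤-refl

mainTheorem8 : (n : ℕ) → .{{_ : NonZero n}} → (a : Fin n → ℕ) →
               IsCircularAreaSeq n a →
               (c : List ℕ → ℤ → ℤ) →
               (∀ (q : ℤ) (N : ℕ) (x : Fin N → ℤ) →
                  Gspec n a N x (q + Data.Integer.+ 1)
                    ≡ eExpansion n (λ λs → c λs q) (toList x)) →
               ∀ (q : ℤ) → c (replicate n 1) q ≡ Data.Integer.+ 1
mainTheorem8 n a _ c expansion q = begin
  c (replicate n 1) q                     ≡⟨ eExpansion-at-one n (λ λs → c λs q) ⟨
  eExpansion n (λ λs → c λs q) [ + 1 ]    ≡⟨ expansion q 1 (λ _ → + 1) ⟨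
  Gspec n a 1 (λ _ → + 1) (q + + 1)       ≡⟨ Gspec-at-one n a (q + + 1) ⟩
  + 1                                     ∎
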